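{- Let $p$ be a prime and $k$ be a positive integer. Then the sequence $S(p,k)$ is eventually periodic.
   Context: For $k\in\mathbb{N}$, define $\varphi_k:\mathbb{N}\setminus\{1\}\to\mathbb{N}\setminus\{1\}$ by $\varphi_k(x)=x+k$ if $x$ is prime, and $\varphi_k(x)=$ the largest prime divisor of $x$ if $x$ is composite. For $x_0\in\mathbb{N}\setminus\{1\}$, $S(x_0,k)$ denotes the sequence $(x_n)_{n\ge0}$ with $x_n=\varphi_k^n(x_0)$, i.e. $x_0,\varphi_k(x_0),\varphi_k^2(x_0),\dots$. A sequence $(x_n)$ is eventually periodic if there exist $m,l\in\mathbb{N}$ with $x_i=x_{i+l}$ for all $i\ge m$. -}

module Defs where

open import Data.Nat using (ℕ; zero; suc; _+_; _≤_; _<_)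
open import Data.Nat.Divisibility using (_∣?_)
open import Data.Nat.Primality using (prime?)
open import Data.Product using (∃; _×_)
open import Relation.Nullary using (does)
open import Relation.Binary.PropositionalEquality using (_≡_)
open import Data.Bool using (if_then_else_; _∧_)

lpdFrom : ℕ → ℕ → ℕ
lpdFrom n zero    = 0
lpdFrom n (suc d) =
  if does (prime? (suc d)) ∧ does (suc d ∣? n) then suc d else lpdFrom n d

-- largest prime divisor of n (meaningful for n ≥ 2)
largestPrimeDivisor : ℕ → ℕ
largestPrimeDivisor n = lpdFrom n n

-- φ_k : x ↦ x + k if x is prime, largest prime divisor of x otherwise
-- (on the domain ℕ ∖ {1}, 'not prime' means composite, except 0 which is
-- never reached from a prime starting value)
φ : ℕ → ℕ → ℕ
φ k x = if does (prime? x) then x + k else largestPrimeDivisor x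

iter : (ℕ → ℕ) → ℕ → ℕ → ℕ
iter f zero    x = x
iter f (suc n) x = f (iter f n x)

S : ℕ → ℕ → ℕ → ℕ
S x₀ k n = iter (φ k) n x₀

EventuallyPeriodic : (ℕ → ℕ) → Set
EventuallyPeriodic x = ∃ λ m → ∃ λ l → 1 ≤ l × (∀ i → m ≤ i → x i ≡ x (i + l))

-- Starting from a prime q, the orbit walks along q, q + k, q + 2k, … while it
-- stays prime, and among the first k + 2 terms of this progression one is
-- divisible by k + 1 and hence composite. A composite x is then sent to a prime
-- factor of size at most x / 2. So every term lies on such a run from a prime
-- q ≤ B, where B = p + (k + 1)k, and is at most B + (k + 1)k ≤ 2B; the new
-- starting primes are again at most B. A bounded orbit repeats a value, after
-- which it is periodic.
module Submission where

open import Defs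
open import Data.Nat
  using (ℕ; _≤_; zero; suc; _+_; _*_; _∸_; _<_; _/_; _%_; z≤n; s≤s; s≤s⁻¹;
         n>1⇒nonTrivial; nonTrivial⇒nonZero; nonTrivial⇒n>1)
open import Data.Nat.Properties
open import Data.Nat.Divisibility using (_∣_; divides; _∣?_; ∣⇒≤; hasNonTrivialDivisor)
open import Data.Nat.DivMod using (m≡m%n+[m/n]*n; m%n<n)
open import Data.Nat.ListAction using (product)
open import Data.Nat.Primality
  using (Prime; prime?; composite⇒¬prime; ¬prime[0]; prime⇒nonTrivial)
open import Data.Nat.Primality.Factorisation using (factorise)
open import Data.Nat.Tactic.RingSolver using (solve-∀)
open import Data.Fin using (Fin; toℕ; fromℕ<)
open import Data.Fin.Properties using (pigeonhole; toℕ-fromℕ<)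
open import Data.List using ([]; _∷_)
open import Data.List.Relation.Unary.All using (_∷_)
open import Data.Product using (∃; ∃₂; _×_; _,_; proj₁)
open import Data.Sum using (_⊎_; inj₁; inj₂)
open import Relation.Nullary using (¬_; yes; no; _×-dec_; contradiction)
open import Relation.Nullary.Decidable using (dec-true; dec-false)
open import Relation.Binary.PropositionalEquality

prime⇒>1 : ∀ {p} → Prime p → 1 < p
prime⇒>1 {p} pr = nonTrivial⇒n>1 p {{prime⇒nonTrivial pr}}

¬prime-of-proper-divisor : ∀ {d n} → 1 < d → d < n → d ∣ n → ¬ Prime n
¬prime-of-proper-divisor 1<d d<n d∣n =
  composite⇒¬prime (hasNonTrivialDivisor {{n>1⇒nonTrivial 1<d}} d<n d∣n)

proper-divisor⇒2*≤ : ∀ {d n} → d ∣ n → d < n → 2 * d ≤ n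
proper-divisor⇒2*≤ {d} (divides 1 refl) d<d+0 =
  contradiction d<d+0 (<-irrefl (sym (+-identityʳ d)))
proper-divisor⇒2*≤ {d} (divides (suc (suc c)) refl) _ = *-monoˡ-≤ d {2} {suc (suc c)} (s≤s (s≤s z≤n))

prime-divisor : ∀ {n} → 1 < n → ∃ λ r → Prime r × r ∣ n
prime-divisor {n} 1<n with factorise n {{nonTrivial⇒nonZero n {{n>1⇒nonTrivial 1<n}}}}
... | record { factors = [] ; isFactorisation = n≡1 } = contradiction n≡1 (>⇒≢ 1<n)
... | record { factors = r ∷ rs ; isFactorisation = n≡r*rs ; factorsPrime = pr ∷ _ } =
  r , pr , divides (product rs) (trans n≡r*rs (*-comm r (product rs)))

module _ {n d : ℕ} where

  lpdFrom-found : Prime (suc d) → suc d ∣ n → lpdFrom n (suc d) ≡ suc d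
  lpdFrom-found p q rewrite dec-true (prime? (suc d)) p | dec-true (suc d ∣? n) q = refl

  lpdFrom-skip : ¬ (Prime (suc d) × suc d ∣ n) → lpdFrom n (suc d) ≡ lpdFrom n d
  lpdFrom-skip ¬pq with prime? (suc d) | suc d ∣? n
  ... | yes p | yes q = contradiction (p , q) ¬pq
  ... | yes _ | no ¬q rewrite dec-false (suc d ∣? n) ¬q = refl
  ... | no _  | _     = refl

lpdFrom-prime-∣ : ∀ {n r} d → Prime r → r ∣ n → r ≤ d → Prime (lpdFrom n d) × lpdFrom n d ∣ n
lpdFrom-prime-∣ zero pr _ r≤0 = contradiction (subst Prime (n≤0⇒n≡0 r≤0) pr) ¬prime[0]
lpdFrom-prime-∣ {n} {r} (suc d) pr r∣n r≤1+d with prime? (suc d) ×-dec suc d ∣? n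
... | yes (p , q) rewrite lpdFrom-found p q = p , q
... | no ¬pq rewrite lpdFrom-skip ¬pq = lpdFrom-prime-∣ d pr r∣n (s≤s⁻¹ (≤∧≢⇒< r≤1+d r≢1+d))
  where
  r≢1+d : r ≢ suc d
  r≢1+d r≡1+d = ¬pq (subst (λ m → Prime m × m ∣ n) r≡1+d (pr , r∣n))

largestPrimeDivisor-prime-∣ : ∀ {n} → 1 < n → Prime (largestPrimeDivisor n) × largestPrimeDivisor n ∣ n
largestPrimeDivisor-prime-∣ {n} 1<n with prime-divisor 1<n
... | r , pr , r∣n = lpdFrom-prime-∣ n pr r∣n (∣⇒≤ {{nonTrivial⇒nonZero n {{n>1⇒nonTrivial 1<n}}}} r∣n)

largestPrimeDivisor-2*≤ : ∀ {n} → 1 < n → ¬ Prime n → 2 * largestPrimeDivisor n ≤ n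
largestPrimeDivisor-2*≤ {n} 1<n ¬pn with largestPrimeDivisor-prime-∣ 1<n
... | pq , q∣n = proper-divisor⇒2*≤ q∣n (≤∧≢⇒< q≤n λ q≡n → ¬pn (subst Prime q≡n pq))
  where
  q≤n : largestPrimeDivisor n ≤ n
  q≤n = ∣⇒≤ {{nonTrivial⇒nonZero n {{n>1⇒nonTrivial 1<n}}}} q∣n

-- Since q + j k ≡ q − j (mod k + 1), take j ≡ q (mod k + 1) with 1 ≤ j ≤ k + 1.
progression-divisible : ∀ q k → ∃ λ j → 1 ≤ j × j ≤ suc k × suc k ∣ q + j * k
progression-divisible q k = suc r , s≤s z≤n , m%n<n (q + k) (suc k) , divides (r + a) q+[1+r]k≡[r+a][1+k]
  where
  r = (q + k) % suc k
  a = (q + k) / suc k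
  rearrange : ∀ r a k → r + a * suc k + r * k ≡ (r + a) * suc k
  rearrange = solve-∀
  q+[1+r]k≡[r+a][1+k] : q + suc r * k ≡ (r + a) * suc k
  q+[1+r]k≡[r+a][1+k] = begin
    q + (k + r * k)        ≡⟨ +-assoc q k (r * k) ⟨
    q + k + r * k          ≡⟨ cong (_+ r * k) (m≡m%n+[m/n]*n (q + k) (suc k)) ⟩
    r + a * suc k + r * k  ≡⟨ rearrange r a k ⟩
    (r + a) * suc k        ∎
    where open ≡-Reasoning

progression-¬prime : ∀ {q k} → Prime q → 1 ≤ k → ∃ λ j → j ≤ suc k × ¬ Prime (q + j * k)
progression-¬prime {q} {k} pq 1≤k with progression-divisible q k
... | j , 1≤j , j≤1+k , 1+k∣ = j , j≤1+k , ¬prime-of-proper-divisor (s≤s 1≤k) 1+k<q+jk 1+k∣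
  where
  1+k<q+jk : suc k < q + j * k
  1+k<q+jk = +-mono-≤ (prime⇒>1 pq) (subst (_≤ j * k) (*-identityˡ k) (*-monoˡ-≤ k 1≤j))

φ-cases : ∀ k x → (Prime x × φ k x ≡ x + k) ⊎ (¬ Prime x × φ k x ≡ largestPrimeDivisor x)
φ-cases k x with prime? x
... | yes px = inj₁ (px , refl)
... | no ¬px = inj₂ (¬px , refl)

-- On a run from the prime q, φ k climbs by k at most up to the non-prime q + j k.
data OnRun (k B : ℕ) : ℕ → Set where
  run : ∀ {q} i j → Prime q → q ≤ B → i ≤ j → j ≤ suc k → ¬ Prime (q + j * k) → OnRun k B (q + i * k)

OnRun-start : ∀ {k B q} → 1 ≤ k → Prime q → q ≤ B → OnRun k B q
OnRun-start {k} {B} {q} 1≤k pq q≤B with progression-¬prime pq 1≤k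
... | j , j≤1+k , ¬pj = subst (OnRun k B) (+-identityʳ q) (run 0 j pq q≤B z≤n j≤1+k ¬pj)

OnRun-bound : ∀ {k B x} → OnRun k B x → x ≤ B + suc k * k
OnRun-bound {k} (run i j _ q≤B i≤j j≤1+k _) = +-mono-≤ q≤B (*-monoˡ-≤ k (≤-trans i≤j j≤1+k))

OnRun-φ : ∀ {k B x} → 1 ≤ k → suc k * k ≤ B → OnRun k B x → OnRun k B (φ k x)
OnRun-φ {k} {B} {x} 1≤k [1+k]k≤B on@(run {q} i j pq q≤B i≤j j≤1+k ¬pj) with φ-cases k x
... | inj₁ (px , φx≡x+k) rewrite φx≡x+k =
  subst (OnRun k B) (sym (+-assoc q (i * k) k)) (subst (λ m → OnRun k B (q + m)) (+-comm k (i * k))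
    (run (suc i) j pq q≤B (≤∧≢⇒< i≤j λ { refl → ¬pj px }) j≤1+k ¬pj))
... | inj₂ (¬px , φx≡r) rewrite φx≡r =
  OnRun-start 1≤k (proj₁ (largestPrimeDivisor-prime-∣ 1<x)) (*-cancelˡ-≤ 2 2r≤2B)
  where
  1<x : 1 < x
  1<x = ≤-trans (prime⇒>1 pq) (m≤m+n q (i * k))
  2r≤2B : 2 * largestPrimeDivisor x ≤ 2 * B
  2r≤2B = begin
    2 * largestPrimeDivisor x  ≤⟨ largestPrimeDivisor-2*≤ 1<x ¬px ⟩
    x                          ≤⟨ OnRun-bound on ⟩
    B + suc k * k              ≤⟨ +-monoʳ-≤ B [1+k]k≤B ⟩
    B + B                      ≡⟨ cong (B +_) (+-identityʳ B) ⟨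
    2 * B                      ∎
    where open ≤-Reasoning

iter-repeats : ∀ (f : ℕ → ℕ) {x m n} → iter f m x ≡ iter f n x → ∀ d → iter f (d + m) x ≡ iter f (d + n) x
iter-repeats f eq zero    = eq
iter-repeats f eq (suc d) = cong f (iter-repeats f eq d)

repeat⇒eventuallyPeriodic : ∀ (f : ℕ → ℕ) x {m l} → 1 ≤ l → iter f m x ≡ iter f (m + l) x →
                            EventuallyPeriodic (λ n → iter f n x)
repeat⇒eventuallyPeriodic f x {m} {l} 1≤l eq = m , l , 1≤l , periodic
  where
  periodic : ∀ n → m ≤ n → iter f n x ≡ iter f (n + l) x
  periodic n m≤n = begin
    iter f n x                  ≡⟨ cong (λ t → iter f t x) (m∸n+n≡m m≤n) ⟨
    iter f (n ∸ m + m) x        ≡⟨ iter-repeats f eq (n ∸ m) ⟩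
    iter f (n ∸ m + (m + l)) x  ≡⟨ cong (λ t → iter f t x) (+-assoc (n ∸ m) m l) ⟨
    iter f (n ∸ m + m + l) x    ≡⟨ cong (λ t → iter f (t + l) x) (m∸n+n≡m m≤n) ⟩
    iter f (n + l) x            ∎
    where open ≡-Reasoning

bounded⇒repeats : ∀ {g : ℕ → ℕ} {N} → (∀ n → g n ≤ N) → ∃₂ λ i j → i < j × g i ≡ g j
bounded⇒repeats {g} {N} bound with pigeonhole (n<1+n (suc N)) clamp
  where
  clamp : Fin (suc (suc N)) → Fin (suc N)
  clamp t = fromℕ< (s≤s (bound (toℕ t)))
... | i , j , i<j , clamp-i≡clamp-j =
  toℕ i , toℕ j , i<j , trans (sym (toℕ-fromℕ< _)) (trans (cong toℕ clamp-i≡clamp-j) (toℕ-fromℕ< _))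

bounded-orbit⇒eventuallyPeriodic : ∀ (f : ℕ → ℕ) x {N} → (∀ n → iter f n x ≤ N) →
                                   EventuallyPeriodic (λ n → iter f n x)
bounded-orbit⇒eventuallyPeriodic f x bound with bounded⇒repeats bound
... | i , j , i<j , eq =
  repeat⇒eventuallyPeriodic f x {i} (m<n⇒0<n∸m i<j) (trans eq (cong (λ t → iter f t x) (sym (m+[n∸m]≡n (<⇒≤ i<j)))))

mainTheorem1 : (p k : ℕ) → Prime p → 1 ≤ k → EventuallyPeriodic (S p k)
mainTheorem1 p k pp 1≤k = bounded-orbit⇒eventuallyPeriodic (φ k) p (λ n → OnRun-bound (orbit-OnRun n))
  where
  B = p + suc k * k
  orbit-OnRun : ∀ n → OnRun k B (S p k n)
  orbit-OnRun zero    = OnRun-start 1≤k pp (m≤m+n p (suc k * k))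
  orbit-OnRun (suc n) = OnRun-φ 1≤k (m≤n+m (suc k * k) p) (orbit-OnRun n)
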